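{- Let $0<r\le 1$ be a real number such that $1/r$ is not an integer, and let $k=\lfloor 1/r\rfloor$. For a positive integer $n$ let $m=n-k\lceil rn\rceil$ and $l=(k+1)\lceil rn\rceil-n$. For positive integers $\beta,\alpha$ let \[ q(\beta,\alpha)=\min\sum_i \omega(\alpha\beta_i,\alpha), \] where the minimum is taken over all ways of writing $\beta=\sum_i\beta_i$ as a sum of positive integers $\beta_i$. Then for all sufficiently large $n$, \[ Q(n,\lceil rn\rceil)\le q(l,k)+q(m,k+1). \]
   Context: All graphs are finite and simple; $\omega(G)$, $\alpha(G)$, $\chi(G)$ denote clique number, independence number and chromatic number, and $|G|$ the number of vertices. For positive integers $n,k$, $\omega(n,k)=\min\{\omega(G): |G|=n \text{ and } \alpha(G)\le k\}$. For positive integers $n,c$, $Q(n,c)=\min\{\omega(G): |G|=n \text{ and } \chi(G)=c\}$. (For large $n$ the quantities $l$ and $m$ are positive integers, so the expressions are defined.) -}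

module Defs where

open import Data.Nat using (ℕ; zero; suc; _+_; _*_; _∸_; _≤_; _<_)
open import Data.Fin using (Fin)
open import Data.Fin.Subset using (Subset; _∈_; ∣_∣)
open import Data.Bool using (Bool; true; false)
open import Data.List using (List; []; _∷_)
open import Data.Nat.ListAction using (sum)
open import Data.List.Relation.Unary.All using (All)
open import Data.List.Relation.Binary.Pointwise using (Pointwise)
open import Data.Product using (Σ; ∃; ∃-syntax; _×_; _,_)
open import Relation.Nullary using (¬_)
open import Relation.Binary.PropositionalEquality using (_≡_; _≢_)

IsMin : (ℕ → Set) → ℕ → Set
IsMin P v = P v × (∀ w → P w → v ≤ w)

IsMax : (ℕ → Set) → ℕ → Set
IsMax P v = P v × (∀ w → P w → w ≤ v)

record Graph (n : ℕ) : Set where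
  field
    adj    : Fin n → Fin n → Bool
    sym    : ∀ i j → adj i j ≡ adj j i
    irrefl : ∀ i → adj i i ≡ false
open Graph public

IsClique : ∀ {n} → Graph n → Subset n → Set
IsClique G S = ∀ i j → i ∈ S → j ∈ S → i ≢ j → adj G i j ≡ true

IsIndep : ∀ {n} → Graph n → Subset n → Set
IsIndep G S = ∀ i j → i ∈ S → j ∈ S → adj G i j ≡ false

CliqueNumber : ∀ {n} → Graph n → ℕ → Set
CliqueNumber G = IsMax (λ s → ∃[ S ] (IsClique G S × ∣ S ∣ ≡ s))

IndepNumber : ∀ {n} → Graph n → ℕ → Set
IndepNumber G = IsMax (λ s → ∃[ S ] (IsIndep G S × ∣ S ∣ ≡ s))

ProperColouring : ∀ {n} → Graph n → (c : ℕ) → (Fin n → Fin c) → Set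
ProperColouring G c f = ∀ i j → adj G i j ≡ true → f i ≢ f j

ChromaticNumber : ∀ {n} → Graph n → ℕ → Set
ChromaticNumber {n} G = IsMin (λ c → Σ (Fin n → Fin c) (ProperColouring G c))

OmegaNK : ℕ → ℕ → ℕ → Set
OmegaNK n k = IsMin (λ w → Σ (Graph n) λ G →
  CliqueNumber G w × ∃[ a ] (IndepNumber G a × a ≤ k))

QNC : ℕ → ℕ → ℕ → Set
QNC n c = IsMin (λ w → Σ (Graph n) λ G → CliqueNumber G w × ChromaticNumber G c)

qSmall : ℕ → ℕ → ℕ → Set
qSmall β α = IsMin (λ s → Σ (List ℕ) λ βs → Σ (List ℕ) λ ws →
  All (λ b → 1 ≤ b) βs × sum βs ≡ β ×
  Pointwise (λ b w → OmegaNK (α * b) α w) βs ws × sum ws ≡ s)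

-- Real numbers r with 0 < r ≤ 1, given by their (open) lower cut on the
-- nonnegative rationals: Below a b  means  a/b < r  (b ≥ 1).

record RealIn01 : Set₁ where
  field
    Below    : ℕ → ℕ → Set
    den-pos  : ∀ {a b} → Below a b → 1 ≤ b
    down     : ∀ {a b a' b'} → 1 ≤ b' → Below a b → a' * b ≤ a * b' → Below a' b'
    rounded  : ∀ {a b} → Below a b → ∃[ a' ] ∃[ b' ] (Below a' b' × a * b' < a' * b)
    positive : Below 0 1
    le-one   : ¬ Below 1 1
open RealIn01 public

IsRecip : RealIn01 → ℕ → Set
IsRecip r j = ¬ Below r 1 j × (∀ a b → 1 ≤ b → a * j < b → Below r a b)

InvNotInteger : RealIn01 → Set
InvNotInteger r = ∀ j → 1 ≤ j → ¬ IsRecip r j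

-- k = ⌊1/r⌋  ⟺  1/(k+1) < r ≤ 1/k  (with k ≥ 1 since r ≤ 1)
IsFloorInv : RealIn01 → ℕ → Set
IsFloorInv r k = 1 ≤ k × Below r 1 (suc k) × ¬ Below r 1 k

-- c = ⌈r n⌉  (n ≥ 1)  ⟺  r ≤ c/n  and  (c-1)/n < r, c ≥ 1
IsCeilMul : RealIn01 → ℕ → ℕ → Set
IsCeilMul r n c = 1 ≤ c × ¬ Below r c n × Below r (c ∸ 1) n

-- Write c = ⌈rn⌉, l = (k+1)c − n, m = n − kc, and fix optimal compositions of l and m. Join
-- (add all edges between) graphs realising ω(k lᵢ, k) and ω((k+1) mⱼ, k+1): the result has
-- k l + (k+1) m = n vertices and clique number at most q(l,k) + q(m,k+1). Give the vertices of
-- the first kind weight k+1 and those of the second kind weight k. An independent set of a join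
-- lies inside one part, so it weighs at most K = k(k+1), while the total weight is K(l+m) = Kc;
-- hence every proper colouring uses at least c colours. Restoring the edges of this graph one
-- vertex at a time, starting from the edgeless graph, raises the chromatic number by at most one
-- per step, so one of these spanning subgraphs has chromatic number exactly c.
--
-- If kc > n (m is then truncated to 0) the first family alone has at least n vertices of weight
-- k+1, and any n of them already force c colours because k(c−1) < n.

module Submission where

open import Defs hiding (sym)

open import Data.Bool using (Bool; true; false; _∧_; if_then_else_)
open import Data.Bool.Properties as Bool using (∧-zeroʳ)
open import Data.Empty using (⊥-elim)
open import Data.Fin as Fin using (Fin; toℕ; fromℕ; inject₁; _↑ˡ_; _↑ʳ_; splitAt)
open import Data.Fin.Properties as Finₚ
  using (splitAt-↑ˡ; splitAt-↑ʳ; ↑ˡ-injective; ↑ʳ-injective; toℕ-injective; toℕ<n;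
         fromℕ≢inject₁; inject₁-injective; any?; all?)
open import Data.Fin.Subset using (Subset; _∈_; ∣_∣; ⊥; inside; outside)
open import Data.Fin.Subset.Properties
  using (_∈?_; ∉⊥; Empty-unique; nonempty?; ∣⊥∣≡0; anySubset?; ∣p∣≤n)
open import Data.List.Relation.Binary.Pointwise using (Pointwise; []; _∷_)
open import Data.Nat
open import Data.Nat.Induction using (<-rec)
open import Data.Nat.ListAction using () renaming (sum to sumᴸ)
open import Data.Nat.Properties
open import Data.Nat.Solver using (module +-*-Solver)
open import Data.Product using (Σ; ∃; ∃-syntax; _×_; _,_; proj₁; proj₂)
open import Data.Sum using (_⊎_; inj₁; inj₂)
open import Data.Vec as Vec using (Vec; []; _∷_; _++_; lookup; tabulate; here; there)
open import Data.Vec.Functional using () renaming (_++_ to _++ᶠ_)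
open import Data.Vec.Functional.Properties using (lookup-++ˡ; lookup-++ʳ)
open import Data.Vec.Properties using (lookup∘tabulate; []=⇒lookup)
open import Function using (_∘_; const)
open import Function.Bundles using (mk⇔)
open import Relation.Binary.PropositionalEquality
open import Relation.Nullary using (Dec; yes; no; does)
open import Relation.Nullary.Decidable using (dec-true; dec-false; does-⇔; map′; _→-dec_; _×-dec_; ¬?)

open import Algebra.Properties.CommutativeMonoid.Sum +-0-commutativeMonoid using (sum; sum-cong-≗; ∑-comm)

-- Finite sums and weights of subsets

sum-mono-≤ : ∀ {n} {f g : Fin n → ℕ} → (∀ i → f i ≤ g i) → sum f ≤ sum g
sum-mono-≤ {zero}  f≤g = z≤n
sum-mono-≤ {suc n} f≤g = +-mono-≤ (f≤g Fin.zero) (sum-mono-≤ (f≤g ∘ Fin.suc))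

sum-const : ∀ n x → sum {n} (const x) ≡ n * x
sum-const zero    x = refl
sum-const (suc n) x = cong (x +_) (sum-const n x)

sum-↑ : ∀ m {n} (f : Fin (m + n) → ℕ) → sum f ≡ sum (f ∘ (_↑ˡ n)) + sum (f ∘ (m ↑ʳ_))
sum-↑ zero    f = refl
sum-↑ (suc m) f = trans (cong (f Fin.zero +_) (sum-↑ m (f ∘ Fin.suc))) (sym (+-assoc (f Fin.zero) _ _))

weightOf : ∀ {n} → Subset n → (Fin n → ℕ) → ℕ
weightOf S w = sum λ i → if lookup S i then w i else 0

weightOf-cong : ∀ {n} (S : Subset n) {w w′} → (∀ i → w i ≡ w′ i) → weightOf S w ≡ weightOf S w′
weightOf-cong S w≗w′ = sum-cong-≗ λ i → cong (if lookup S i then_else 0) (w≗w′ i)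

weightOf-const : ∀ {n} (S : Subset n) d → weightOf S (const d) ≡ ∣ S ∣ * d
weightOf-const []            d = refl
weightOf-const (inside ∷ S)  d = cong (d +_) (weightOf-const S d)
weightOf-const (outside ∷ S) d = weightOf-const S d

weightOf-⊥ : ∀ n (w : Fin n → ℕ) → weightOf ⊥ w ≡ 0
weightOf-⊥ zero    w = refl
weightOf-⊥ (suc n) w = weightOf-⊥ n (w ∘ Fin.suc)

∣∣-++⊥ : ∀ {m} n (S : Subset m) → ∣ S ++ ⊥ {n = n} ∣ ≡ ∣ S ∣
∣∣-++⊥ n []            = ∣⊥∣≡0 n
∣∣-++⊥ n (inside ∷ S)  = cong suc (∣∣-++⊥ n S)
∣∣-++⊥ n (outside ∷ S) = ∣∣-++⊥ n S

weightOf-++ : ∀ {m n} (L : Subset m) (R : Subset n) w →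
  weightOf (L ++ R) w ≡ weightOf L (w ∘ (_↑ˡ n)) + weightOf R (w ∘ (m ↑ʳ_))
weightOf-++ []      R w = refl
weightOf-++ (x ∷ L) R w =
  trans (cong (wᵢ +_) (weightOf-++ L R (w ∘ Fin.suc))) (sym (+-assoc wᵢ _ _))
  where wᵢ = if x then w Fin.zero else 0

weightOf-++⊥ : ∀ {m} n (S : Subset m) w → weightOf (S ++ ⊥ {n = n}) w ≡ weightOf S (w ∘ (_↑ˡ n))
weightOf-++⊥ n S w = trans (weightOf-++ S ⊥ w)
  (trans (cong (weightOf S (w ∘ (_↑ˡ n)) +_) (weightOf-⊥ n _)) (+-identityʳ _))

∣∣-++ : ∀ {m n} (L : Subset m) (R : Subset n) → ∣ L ++ R ∣ ≡ ∣ L ∣ + ∣ R ∣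
∣∣-++ []            R = refl
∣∣-++ (inside ∷ L)  R = cong suc (∣∣-++ L R)
∣∣-++ (outside ∷ L) R = ∣∣-++ L R

∈-↑ˡ : ∀ {m n} {x : Fin m} {L : Subset m} (R : Subset n) → x ∈ L → x ↑ˡ n ∈ L ++ R
∈-↑ˡ R here        = here
∈-↑ˡ R (there x∈L) = there (∈-↑ˡ R x∈L)

∈-↑ʳ : ∀ {m n} {y : Fin n} (L : Subset m) {R : Subset n} → y ∈ R → m ↑ʳ y ∈ L ++ R
∈-↑ʳ []      y∈R = y∈R
∈-↑ʳ (_ ∷ L) y∈R = there (∈-↑ʳ L y∈R)

∈-++⁻ : ∀ {m n} (L : Subset m) {R : Subset n} {i} → i ∈ L ++ R →
  (∃[ x ] (x ↑ˡ n ≡ i × x ∈ L)) ⊎ (∃[ y ] (m ↑ʳ y ≡ i × y ∈ R))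
∈-++⁻ []      i∈R = inj₂ (_ , refl , i∈R)
∈-++⁻ (_ ∷ L) here = inj₁ (Fin.zero , refl , here)
∈-++⁻ (_ ∷ L) (there i∈) with ∈-++⁻ L i∈
... | inj₁ (x , refl , x∈L) = inj₁ (Fin.suc x , refl , there x∈L)
... | inj₂ (y , refl , y∈R) = inj₂ (y , refl , y∈R)

-- Joins and initial subgraphs

true≢false : true ≢ false
true≢false ()

joinAdj : ∀ {m n} → Graph m → Graph n → Fin m ⊎ Fin n → Fin m ⊎ Fin n → Bool
joinAdj G H (inj₁ x) (inj₁ y) = adj G x y
joinAdj G H (inj₂ x) (inj₂ y) = adj H x y
joinAdj G H _        _        = true

join : ∀ {m n} → Graph m → Graph n → Graph (m + n)
join {m} G H = record
  { adj    = λ i j → joinAdj G H (splitAt m i) (splitAt m j)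
  ; sym    = λ i j → symmetric (splitAt m i) (splitAt m j)
  ; irrefl = λ i → irreflexive (splitAt m i)
  }
  where
  symmetric : ∀ u v → joinAdj G H u v ≡ joinAdj G H v u
  symmetric (inj₁ x) (inj₁ y) = Graph.sym G x y
  symmetric (inj₂ x) (inj₂ y) = Graph.sym H x y
  symmetric (inj₁ x) (inj₂ y) = refl
  symmetric (inj₂ x) (inj₁ y) = refl
  irreflexive : ∀ u → joinAdj G H u u ≡ false
  irreflexive (inj₁ x) = irrefl G x
  irreflexive (inj₂ x) = irrefl H x

module _ {m n} (G : Graph m) (H : Graph n) where

  join-↑ˡ : ∀ x y → adj (join G H) (x ↑ˡ n) (y ↑ˡ n) ≡ adj G x y
  join-↑ˡ x y = cong₂ (joinAdj G H) (splitAt-↑ˡ m x n) (splitAt-↑ˡ m y n)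

  join-↑ʳ : ∀ x y → adj (join G H) (m ↑ʳ x) (m ↑ʳ y) ≡ adj H x y
  join-↑ʳ x y = cong₂ (joinAdj G H) (splitAt-↑ʳ m n x) (splitAt-↑ʳ m n y)

  join-↑ˡ↑ʳ : ∀ x y → adj (join G H) (x ↑ˡ n) (m ↑ʳ y) ≡ true
  join-↑ˡ↑ʳ x y = cong₂ (joinAdj G H) (splitAt-↑ˡ m x n) (splitAt-↑ʳ m n y)

  clique-↑ˡ : ∀ {L R} → IsClique (join G H) (L ++ R) → IsClique G L
  clique-↑ˡ {L} {R} cl x y x∈L y∈L x≢y = trans (sym (join-↑ˡ x y))
    (cl _ _ (∈-↑ˡ R x∈L) (∈-↑ˡ R y∈L) (x≢y ∘ ↑ˡ-injective n x y))

  clique-↑ʳ : ∀ {L R} → IsClique (join G H) (L ++ R) → IsClique H R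
  clique-↑ʳ {L} cl x y x∈R y∈R x≢y = trans (sym (join-↑ʳ x y))
    (cl _ _ (∈-↑ʳ L x∈R) (∈-↑ʳ L y∈R) (x≢y ∘ ↑ʳ-injective m x y))

  indep-↑ˡ : ∀ {L R} → IsIndep (join G H) (L ++ R) → IsIndep G L
  indep-↑ˡ {L} {R} ind x y x∈L y∈L =
    trans (sym (join-↑ˡ x y)) (ind _ _ (∈-↑ˡ R x∈L) (∈-↑ˡ R y∈L))

  indep-↑ʳ : ∀ {L R} → IsIndep (join G H) (L ++ R) → IsIndep H R
  indep-↑ʳ {L} ind x y x∈R y∈R =
    trans (sym (join-↑ʳ x y)) (ind _ _ (∈-↑ʳ L x∈R) (∈-↑ʳ L y∈R))

  indep-one-sided : ∀ {L R} → IsIndep (join G H) (L ++ R) → L ≡ ⊥ ⊎ R ≡ ⊥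
  indep-one-sided {L} {R} ind with nonempty? L
  ... | no  L-empty     = inj₁ (Empty-unique L-empty)
  ... | yes (x , x∈L) = inj₂ (Empty-unique λ (y , y∈R) →
          true≢false (trans (sym (join-↑ˡ↑ʳ x y)) (ind _ _ (∈-↑ˡ R x∈L) (∈-↑ʳ L y∈R))))

module _ {m n} (G : Graph (m + n)) where

  initial : Graph m
  initial = record
    { adj    = λ x y → adj G (x ↑ˡ n) (y ↑ˡ n)
    ; sym    = λ x y → Graph.sym G (x ↑ˡ n) (y ↑ˡ n)
    ; irrefl = λ x → irrefl G (x ↑ˡ n)
    }

  private
    ∈-++⊥⁻ : ∀ {S : Subset m} {i} → i ∈ S ++ ⊥ → ∃[ x ] (x ↑ˡ n ≡ i × x ∈ S)
    ∈-++⊥⁻ {S} i∈ with ∈-++⁻ S i∈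
    ... | inj₁ found         = found
    ... | inj₂ (_ , _ , y∈⊥) = ⊥-elim (∉⊥ y∈⊥)

  clique-initial : ∀ {S} → IsClique initial S → IsClique G (S ++ ⊥)
  clique-initial cl i j i∈ j∈ i≢j with ∈-++⊥⁻ i∈ | ∈-++⊥⁻ j∈
  ... | x , refl , x∈S | y , refl , y∈S = cl x y x∈S y∈S (i≢j ∘ cong (_↑ˡ n))

  indep-initial : ∀ {S} → IsIndep initial S → IsIndep G (S ++ ⊥)
  indep-initial ind i j i∈ j∈ with ∈-++⊥⁻ i∈ | ∈-++⊥⁻ j∈
  ... | x , refl , x∈S | y , refl , y∈S = ind x y x∈S y∈S

-- Weighted graphs

record WeightedGraph (d K n W T : ℕ) : Set where
  field
    graph          : Graph n
    weight         : Fin n → ℕ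
    weight-≥       : ∀ i → d ≤ weight i
    clique-≤       : ∀ S → IsClique graph S → ∣ S ∣ ≤ W
    indep-weight-≤ : ∀ S → IsIndep graph S → weightOf S weight ≤ K
    total          : sum weight ≡ T
open WeightedGraph

module _ {d K : ℕ} where

  cast : ∀ {n n′ W T T′} → n ≡ n′ → T ≡ T′ →
         WeightedGraph d K n W T → WeightedGraph d K n′ W T′
  cast refl refl g = g

  empty : WeightedGraph d K 0 0 0
  empty = record
    { graph          = record { adj = λ () ; sym = λ () ; irrefl = λ () }
    ; weight         = λ ()
    ; weight-≥       = λ ()
    ; clique-≤       = λ { [] _ → z≤n }
    ; indep-weight-≤ = λ { [] _ → z≤n }
    ; total          = refl
    }

  total-≥ : ∀ {n W T} → WeightedGraph d K n W T → n * d ≤ T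
  total-≥ {n} {T = T} g = begin
    n * d              ≡⟨ sum-const n d ⟨
    sum {n} (const d)  ≤⟨ sum-mono-≤ (weight-≥ g) ⟩
    sum (weight g)     ≡⟨ total g ⟩
    T                  ∎
    where open ≤-Reasoning

  weaken : ∀ {d′ n W T} → d′ ≤ d → WeightedGraph d K n W T → WeightedGraph d′ K n W T
  weaken d′≤d g = record
    { graph = graph g ; weight = weight g ; weight-≥ = λ i → ≤-trans d′≤d (weight-≥ g i)
    ; clique-≤ = clique-≤ g ; indep-weight-≤ = indep-weight-≤ g ; total = total g }

  joinWeighted : ∀ {m n W₁ W₂ T₁ T₂} → WeightedGraph d K m W₁ T₁ → WeightedGraph d K n W₂ T₂ →
                 WeightedGraph d K (m + n) (W₁ + W₂) (T₁ + T₂)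
  joinWeighted {m} {n} {W₁} {W₂} g₁ g₂ = record
    { graph          = join G₁ G₂
    ; weight         = w
    ; weight-≥       = weight-≥′
    ; clique-≤       = clique-≤′
    ; indep-weight-≤ = indep-weight-≤′
    ; total          = trans (sum-↑ m w) (cong₂ _+_
                         (trans (sum-cong-≗ (lookup-++ˡ w₁ w₂)) (total g₁))
                         (trans (sum-cong-≗ (lookup-++ʳ w₁ w₂)) (total g₂)))
    }
    where
    G₁ = graph g₁
    G₂ = graph g₂
    w₁ = weight g₁
    w₂ = weight g₂
    w  = w₁ ++ᶠ w₂

    weight-≥′ : ∀ i → d ≤ w i
    weight-≥′ i with splitAt m i
    ... | inj₁ x = weight-≥ g₁ x
    ... | inj₂ y = weight-≥ g₂ y

    weightOf-join : ∀ L R → weightOf (L ++ R) w ≡ weightOf L w₁ + weightOf R w₂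
    weightOf-join L R = trans (weightOf-++ L R w)
      (cong₂ _+_ (weightOf-cong L (lookup-++ˡ w₁ w₂)) (weightOf-cong R (lookup-++ʳ w₁ w₂)))

    clique-≤′ : ∀ S → IsClique (join G₁ G₂) S → ∣ S ∣ ≤ W₁ + W₂
    clique-≤′ S cl with Vec.splitAt m S
    ... | L , R , refl = begin
      ∣ L ++ R ∣     ≡⟨ ∣∣-++ L R ⟩
      ∣ L ∣ + ∣ R ∣  ≤⟨ +-mono-≤ (clique-≤ g₁ L (clique-↑ˡ G₁ G₂ cl))
                                (clique-≤ g₂ R (clique-↑ʳ G₁ G₂ cl)) ⟩
      W₁ + W₂        ∎
      where open ≤-Reasoning

    indep-weight-≤′ : ∀ S → IsIndep (join G₁ G₂) S → weightOf S w ≤ K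
    indep-weight-≤′ S ind with Vec.splitAt m S
    ... | L , R , refl with indep-one-sided G₁ G₂ {L} {R} ind
    ...   | inj₁ refl = begin
      weightOf (⊥ ++ R) w        ≡⟨ weightOf-join ⊥ R ⟩
      weightOf ⊥ w₁ + weightOf R w₂ ≡⟨ cong (_+ weightOf R w₂) (weightOf-⊥ m w₁) ⟩
      weightOf R w₂              ≤⟨ indep-weight-≤ g₂ R (indep-↑ʳ G₁ G₂ ind) ⟩
      K                          ∎
      where open ≤-Reasoning
    ...   | inj₂ refl = begin
      weightOf (L ++ ⊥) w        ≡⟨ weightOf-join L ⊥ ⟩
      weightOf L w₁ + weightOf ⊥ w₂ ≡⟨ cong (weightOf L w₁ +_) (weightOf-⊥ n w₂) ⟩
      weightOf L w₁ + 0          ≡⟨ +-identityʳ _ ⟩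
      weightOf L w₁              ≤⟨ indep-weight-≤ g₁ L (indep-↑ˡ G₁ G₂ ind) ⟩
      K                          ∎
      where open ≤-Reasoning

  restrict : ∀ {m n W T} (g : WeightedGraph d K (m + n) W T) →
             WeightedGraph d K m W (sum (weight g ∘ (_↑ˡ n)))
  restrict {n = n} {W} g = record
    { graph          = initial (graph g)
    ; weight         = weight g ∘ (_↑ˡ n)
    ; weight-≥       = weight-≥ g ∘ (_↑ˡ n)
    ; clique-≤       = λ S cl → subst (_≤ W) (∣∣-++⊥ n S)
                         (clique-≤ g (S ++ ⊥) (clique-initial (graph g) cl))
    ; indep-weight-≤ = λ S ind → subst (_≤ K) (weightOf-++⊥ n S (weight g))
                         (indep-weight-≤ g (S ++ ⊥) (indep-initial (graph g) ind))
    ; total          = refl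
    }

module _ {α d K : ℕ} (α*d≡K : α * d ≡ K) where

  fromOmegaNK : ∀ {b w} → OmegaNK (α * b) α w → WeightedGraph d K (α * b) w (b * K)
  fromOmegaNK {b} ((G , (_ , clique-max) , a , (_ , indep-max) , a≤α) , _) = record
    { graph          = G
    ; weight         = const d
    ; weight-≥       = λ _ → ≤-refl
    ; clique-≤       = λ S cl → clique-max ∣ S ∣ (S , cl , refl)
    ; indep-weight-≤ = λ S ind → begin
        weightOf S (const d) ≡⟨ weightOf-const S d ⟩
        ∣ S ∣ * d            ≤⟨ *-monoˡ-≤ d (≤-trans (indep-max ∣ S ∣ (S , ind , refl)) a≤α) ⟩
        α * d                ≡⟨ α*d≡K ⟩
        K                    ∎
    ; total          = begin-equality
        sum {α * b} (const d) ≡⟨ sum-const (α * b) d ⟩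
        α * b * d             ≡⟨ cong (_* d) (*-comm α b) ⟩
        b * α * d             ≡⟨ *-assoc b α d ⟩
        b * (α * d)           ≡⟨ cong (b *_) α*d≡K ⟩
        b * K                 ∎
    }
    where open ≤-Reasoning

  compositionGraph : ∀ {βs ws} → Pointwise (λ b w → OmegaNK (α * b) α w) βs ws →
                     WeightedGraph d K (α * sumᴸ βs) (sumᴸ ws) (sumᴸ βs * K)
  compositionGraph []       = cast (sym (*-zeroʳ α)) refl empty
  compositionGraph (_∷_ {x = b} {xs = βs} p ps) =
    cast (sym (*-distribˡ-+ α b (sumᴸ βs))) (sym (*-distribʳ-+ K b (sumᴸ βs)))
    (joinWeighted (fromOmegaNK p) (compositionGraph ps))

  qSmall⇒weighted : ∀ {β q} → qSmall β α q → WeightedGraph d K (α * β) q (β * K)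
  qSmall⇒weighted ((_ , _ , _ , refl , parts , refl) , _) = compositionGraph parts

-- Colourings

Colourable : ∀ {n} → Graph n → ℕ → Set
Colourable {n} G c = Σ (Fin n → Fin c) (ProperColouring G c)

colourClass : ∀ {n c} → (Fin n → Fin c) → Fin c → Subset n
colourClass f x = tabulate λ i → does (f i Finₚ.≟ x)

∈-colourClass⁻ : ∀ {n c} (f : Fin n → Fin c) {x i} → i ∈ colourClass f x → f i ≡ x
∈-colourClass⁻ f {x} {i} i∈ with f i Finₚ.≟ x | trans (sym (lookup∘tabulate _ i)) ([]=⇒lookup i∈)
... | yes fi≡x | _ = fi≡x

colourClass-indep : ∀ {n c} (G : Graph n) {f : Fin n → Fin c} → ProperColouring G c f →
                    ∀ x → IsIndep G (colourClass f x)
colourClass-indep G {f} proper x i j i∈ j∈ with adj G i j in edge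
... | true  = ⊥-elim (proper i j edge (trans (∈-colourClass⁻ f i∈) (sym (∈-colourClass⁻ f j∈))))
... | false = refl

sum-indicator : ∀ {c} (y : Fin c) w → sum (λ x → if does (y Finₚ.≟ x) then w else 0) ≡ w
sum-indicator {suc c} Fin.zero    w =
  trans (cong (w +_) (trans (sum-const c 0) (*-zeroʳ c))) (+-identityʳ w)
sum-indicator {suc c} (Fin.suc y) w = sum-indicator y w

sum-colourClasses : ∀ {n c} (f : Fin n → Fin c) w → sum w ≡ sum λ x → weightOf (colourClass f x) w
sum-colourClasses f w = begin
  sum w                                     ≡⟨ sum-cong-≗ (λ i → sum-indicator (f i) (w i)) ⟨
  sum (λ i → sum λ x → δ (f i) x (w i))     ≡⟨ ∑-comm (λ i x → δ (f i) x (w i)) ⟩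
  sum (λ x → sum λ i → δ (f i) x (w i))     ≡⟨ sum-cong-≗ (λ x → sum-cong-≗ λ i → cong (if_then w i else 0)
                                                (lookup∘tabulate (λ j → does (f j Finₚ.≟ x)) i)) ⟨
  sum (λ x → weightOf (colourClass f x) w)  ∎
  where
  open ≡-Reasoning
  δ : ∀ {c} → Fin c → Fin c → ℕ → ℕ
  δ a b v = if does (a Finₚ.≟ b) then v else 0

colourable⇒total-≤ : ∀ {d K n W T c} (g : WeightedGraph d K n W T) → Colourable (graph g) c → T ≤ c * K
colourable⇒total-≤ {K = K} {T = T} {c} g (f , proper) = begin
  T                                                ≡⟨ total g ⟨
  sum (weight g)                                   ≡⟨ sum-colourClasses f (weight g) ⟩
  sum (λ x → weightOf (colourClass f x) (weight g)) ≤⟨ sum-mono-≤ (λ x → indep-weight-≤ g _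
                                                       (colourClass-indep (graph g) proper x)) ⟩
  sum {c} (const K)                                ≡⟨ sum-const c K ⟩
  c * K                                            ∎
  where open ≤-Reasoning

-- Existence of chromatic and clique numbers

least : {P : ℕ → Set} → (∀ m → Dec (P m)) → ∀ n → P n → ∃ (IsMin P)
least {P} P? = <-rec (λ n → P n → ∃ (IsMin P)) search
  where
  search : ∀ n → (∀ {m} → m < n → P m → ∃ (IsMin P)) → P n → ∃ (IsMin P)
  search n below Pn with anyUpTo? P? n
  ... | yes (m , m<n , Pm) = below m<n Pm
  ... | no  none           = n , Pn , λ m Pm → ≮⇒≥ λ m<n → none (m , m<n , Pm)

greatest : {P : ℕ → Set} → (∀ m → Dec (P m)) →
           ∀ b → (∀ m → P m → m ≤ b) → ∃ P → ∃ (IsMax P)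
greatest P? b bounded (m , Pm) with P? b
greatest     P? b       bounded _        | yes Pb = b , Pb , bounded
greatest {P} P? zero    bounded (m , Pm) | no ¬Pb = ⊥-elim (¬Pb (subst P (n≤0⇒n≡0 (bounded m Pm)) Pm))
greatest     P? (suc b) bounded (m , Pm) | no ¬Pb =
  greatest P? b (λ m′ Pm′ → ≤-pred (≤∧≢⇒< (bounded m′ Pm′) λ { refl → ¬Pb Pm′ })) (m , Pm)

anyVec? : ∀ {m n} {P : Vec (Fin m) n → Set} → (∀ v → Dec (P v)) → Dec (∃ P)
anyVec? {n = zero}  P? = map′ ([] ,_) (λ { ([] , p) → p }) (P? [])
anyVec? {n = suc n} P? = map′ (λ (x , v , p) → x ∷ v , p) (λ { (x ∷ v , p) → x , v , p })
  (any? λ x → anyVec? λ v → P? (x ∷ v))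

colourable? : ∀ {n} (G : Graph n) c → Dec (Colourable G c)
colourable? G c = map′ (λ (v , p) → lookup v , p) (λ (f , p) → tabulate f , proper-tabulate f p)
  (anyVec? λ v → proper? (lookup v))
  where
  proper? : ∀ f → Dec (ProperColouring G c f)
  proper? f = all? λ i → all? λ j → (adj G i j Bool.≟ true) →-dec ¬? (f i Finₚ.≟ f j)
  proper-tabulate : ∀ f → ProperColouring G c f → ProperColouring G c (lookup (tabulate f))
  proper-tabulate f p i j e = p i j e ∘ subst₂ _≡_ (lookup∘tabulate f i) (lookup∘tabulate f j)

clique? : ∀ {n} (G : Graph n) S → Dec (IsClique G S)
clique? G S = all? λ i → all? λ j →
  (i ∈? S) →-dec (j ∈? S) →-dec ¬? (i Finₚ.≟ j) →-dec (adj G i j Bool.≟ true)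

chromaticNumber : ∀ {n} (G : Graph n) → ∃ (ChromaticNumber G)
chromaticNumber {n} G = least (colourable? G) n ((λ i → i) , distinct)
  where
  distinct : ProperColouring G n (λ i → i)
  distinct i j e refl = true≢false (trans (sym e) (irrefl G i))

cliqueNumber : ∀ {n} (G : Graph n) → ∃ (CliqueNumber G)
cliqueNumber {n} G = greatest (λ s → anySubset? λ S → clique? G S ×-dec (∣ S ∣ ≟ s))
  n (λ { _ (S , _ , refl) → ∣p∣≤n S }) (0 , ⊥ , (λ _ _ i∈⊥ → ⊥-elim (∉⊥ i∈⊥)) , ∣⊥∣≡0 n)

-- Spanning subgraphs of prescribed chromatic number

below : ∀ {n} → ℕ → Fin n → Bool
below t i = does (toℕ i <? t)

below-suc : ∀ {n t} {i : Fin n} → toℕ i ≢ t → below (suc t) i ≡ below t i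
below-suc {t = t} {i} i≢t =
  does-⇔ (mk⇔ (λ i<1+t → ≤∧≢⇒< (≤-pred i<1+t) i≢t) m<n⇒m<1+n) (toℕ i <? suc t) (toℕ i <? t)

prefixEdges : ∀ {n} → ℕ → Graph n → Graph n
prefixEdges t G = record
  { adj    = λ i j → below t i ∧ below t j ∧ adj G i j
  ; sym    = symmetric
  ; irrefl = irreflexive
  }
  where
  symmetric : ∀ i j → below t i ∧ below t j ∧ adj G i j ≡ below t j ∧ below t i ∧ adj G j i
  symmetric i j rewrite Graph.sym G i j with below t i | below t j
  ... | true  | true  = refl
  ... | true  | false = refl
  ... | false | true  = refl
  ... | false | false = refl
  irreflexive : ∀ i → below t i ∧ below t i ∧ adj G i i ≡ false
  irreflexive i rewrite irrefl G i = trans (cong (below t i ∧_) (∧-zeroʳ (below t i))) (∧-zeroʳ (below t i))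

module _ {n} (G : Graph n) where

  prefixEdges-⊆ : ∀ t i j → adj (prefixEdges t G) i j ≡ true → adj G i j ≡ true
  prefixEdges-⊆ t i j e with below t i | below t j
  ... | true  | true = e

  clique-prefixEdges : ∀ t S → IsClique (prefixEdges t G) S → IsClique G S
  clique-prefixEdges t S cl i j i∈ j∈ i≢j = prefixEdges-⊆ t i j (cl i j i∈ j∈ i≢j)

  colourable-prefixEdges-zero : ∀ c → Colourable (prefixEdges 0 G) (suc c)
  colourable-prefixEdges-zero c = const Fin.zero , λ i j e → ⊥-elim (true≢false (trans (sym e) (no-edge i j)))
    where
    no-edge : ∀ i j → adj (prefixEdges 0 G) i j ≡ false
    no-edge i j = cong (_∧ (below 0 j ∧ adj G i j)) (dec-false (toℕ i <? 0) λ ())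

  prefixEdges-full : ∀ i j → adj (prefixEdges n G) i j ≡ adj G i j
  prefixEdges-full i j rewrite dec-true (toℕ i <? n) (toℕ<n i) | dec-true (toℕ j <? n) (toℕ<n j) = refl

  colourable-prefixEdges-full : ∀ {c} → Colourable (prefixEdges n G) c → Colourable G c
  colourable-prefixEdges-full (f , proper) = f , λ i j e → proper i j (trans (prefixEdges-full i j) e)

  prefixEdges-suc : ∀ {t i j} → toℕ i ≢ t → toℕ j ≢ t →
                    adj (prefixEdges (suc t) G) i j ≡ adj (prefixEdges t G) i j
  prefixEdges-suc {i = i} {j} i≢t j≢t = cong₂ (λ a b → a ∧ b ∧ adj G i j) (below-suc i≢t) (below-suc j≢t)

  colourable-prefixEdges-suc : ∀ {t c} → Colourable (prefixEdges t G) c →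
                               Colourable (prefixEdges (suc t) G) (suc c)
  colourable-prefixEdges-suc {t} {c} (f , proper) = f′ , proper′
    where
    f′ : Fin n → Fin (suc c)
    f′ i with toℕ i ≟ t
    ... | yes _ = fromℕ c
    ... | no  _ = inject₁ (f i)
    proper′ : ProperColouring (prefixEdges (suc t) G) (suc c) f′
    proper′ i j e with toℕ i ≟ t | toℕ j ≟ t
    ... | yes _   | no  _   = fromℕ≢inject₁
    ... | no  _   | yes _   = fromℕ≢inject₁ ∘ sym
    ... | no  i≢t | no  j≢t = proper i j (trans (sym (prefixEdges-suc i≢t j≢t)) e) ∘ inject₁-injective
    ... | yes i≡t | yes j≡t with toℕ-injective (trans i≡t (sym j≡t))
    ...   | refl = λ _ → true≢false (trans (sym (prefixEdges-⊆ (suc t) i i e)) (irrefl G i))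

intermediate-value : (f : ℕ → ℕ) → (∀ t → f (suc t) ≤ suc (f t)) →
                     ∀ {c} N → f 0 ≤ c → c ≤ f N → ∃[ t ] f t ≡ c
intermediate-value f step zero    f₀≤c c≤f₀ = 0 , ≤-antisym f₀≤c c≤f₀
intermediate-value f step {c} (suc N) f₀≤c c≤f₁₊N with c ≤? f N
... | yes c≤fN = intermediate-value f step N f₀≤c c≤fN
... | no  c≰fN = suc N , ≤-antisym (≤-trans (step N) (≰⇒> c≰fN)) c≤f₁₊N

prefixEdges-chromatic : ∀ {n c} (G : Graph n) → (∀ {c′} → Colourable G c′ → c < c′) →
                        ∃[ t ] ChromaticNumber (prefixEdges t G) (suc c)
prefixEdges-chromatic {n} {c} G needs-more =
  let t , χₜ≡1+c = intermediate-value χ χ-step n χ₀≤1+c 1+c≤χₙ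
  in t , subst (ChromaticNumber (prefixEdges t G)) χₜ≡1+c (proj₂ (χ-spec t))
  where
  χ-spec : ∀ t → ∃ (ChromaticNumber (prefixEdges t G))
  χ-spec t = chromaticNumber (prefixEdges t G)
  χ : ℕ → ℕ
  χ t = proj₁ (χ-spec t)
  χ-colourable : ∀ t → Colourable (prefixEdges t G) (χ t)
  χ-colourable t = proj₁ (proj₂ (χ-spec t))
  χ-least : ∀ t {c′} → Colourable (prefixEdges t G) c′ → χ t ≤ c′
  χ-least t = proj₂ (proj₂ (χ-spec t)) _
  χ-step : ∀ t → χ (suc t) ≤ suc (χ t)
  χ-step t = χ-least (suc t) (colourable-prefixEdges-suc G (χ-colourable t))
  χ₀≤1+c : χ 0 ≤ suc c
  χ₀≤1+c = χ-least 0 (colourable-prefixEdges-zero G c)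
  1+c≤χₙ : suc c ≤ χ n
  1+c≤χₙ = needs-more (colourable-prefixEdges-full G (χ-colourable n))

Q≤-if-not-colourable : ∀ {n c W Qv} (G : Graph n) → (∀ S → IsClique G S → ∣ S ∣ ≤ W) →
                       (∀ {c′} → Colourable G c′ → c < c′) → QNC n (suc c) Qv → Qv ≤ W
Q≤-if-not-colourable {W = W} G clique-≤ needs-more (_ , Q-min) =
  let t , χₜ = prefixEdges-chromatic G needs-more
      w , ω-spec = cliqueNumber (prefixEdges t G)
      S , S-clique , ∣S∣≡w = proj₁ ω-spec
  in ≤-trans (Q-min w (prefixEdges t G , ω-spec , χₜ))
             (subst (_≤ W) ∣S∣≡w (clique-≤ S (clique-prefixEdges G t S S-clique)))

weighted⇒Q≤ : ∀ {d K n W T c Qv} → WeightedGraph d K n W T → c * K < T → QNC n (suc c) Qv → Qv ≤ W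
weighted⇒Q≤ {K = K} {c = c} g cK<T = Q≤-if-not-colourable (graph g) (clique-≤ g)
  λ {c′} colourable → *-cancelʳ-< K c c′ (<-≤-trans cK<T (colourable⇒total-≤ g colourable))

weighted⇒Q≤-subgraph : ∀ {d K N W T n c Qv} → WeightedGraph d K N W T → n ≤ N → c * K < n * d →
                       QNC n (suc c) Qv → Qv ≤ W
weighted⇒Q≤-subgraph {d} {N = N} {n = n} g n≤N cK<nd =
  weighted⇒Q≤ sub (<-≤-trans cK<nd (total-≥ sub))
  where sub = restrict (cast (sym (m+[n∸m]≡n n≤N)) refl g)

-- The two cases of the main bound

ceil-bounds : ∀ r {k n c} → IsFloorInv r k → 1 ≤ n → IsCeilMul r n c →
              n ≤ suc k * c × k * (c ∸ 1) < n
ceil-bounds r {k} {n} {c} (1≤k , 1/[1+k]<r , r≤1/k) 1≤n (_ , r≤c/n , [c-1]/n<r) = upper , lower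
  where
  open ≤-Reasoning
  upper : n ≤ suc k * c
  upper with n ≤? suc k * c
  ... | yes n≤ = n≤
  ... | no  n≰ = ⊥-elim (r≤c/n (down r 1≤n 1/[1+k]<r (begin
    c * suc k ≡⟨ *-comm c (suc k) ⟩
    suc k * c ≤⟨ <⇒≤ (≰⇒> n≰) ⟩
    n         ≡⟨ *-identityˡ n ⟨
    1 * n     ∎)))
  lower : k * (c ∸ 1) < n
  lower with n ≤? k * (c ∸ 1)
  ... | no  n≰ = ≰⇒> n≰
  ... | yes n≤ = ⊥-elim (r≤1/k (down r 1≤k [c-1]/n<r (begin
    1 * n         ≡⟨ *-identityˡ n ⟩
    n             ≤⟨ n≤ ⟩
    k * (c ∸ 1)   ≡⟨ *-comm k (c ∸ 1) ⟩
    (c ∸ 1) * k   ∎)))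

module _ (k c : ℕ) {n : ℕ} (n≤[1+k]c : n ≤ suc k * c) where

  private
    l = suc k * c ∸ n
    m = n ∸ k * c

    l+n≡[1+k]c : l + n ≡ suc k * c
    l+n≡[1+k]c = m∸n+n≡m n≤[1+k]c

  parts-balanced : k * c ≤ n → l + m ≡ c × k * l + suc k * m ≡ n
  parts-balanced kc≤n = l+m≡c , (begin
    k * l + suc k * m ≡⟨ solve 3 (λ k l m → k :* l :+ (m :+ k :* m) := m :+ k :* (l :+ m)) refl k l m ⟩
    m + k * (l + m)   ≡⟨ cong (λ x → m + k * x) l+m≡c ⟩
    m + k * c         ≡⟨ m∸n+n≡m kc≤n ⟩
    n                 ∎)
    where
    open ≡-Reasoning
    open +-*-Solver
    l+m≡c : l + m ≡ c
    l+m≡c = +-cancelʳ-≡ (k * c) (l + m) c (begin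
      l + m + k * c   ≡⟨ +-assoc l m (k * c) ⟩
      l + (m + k * c) ≡⟨ cong (l +_) (m∸n+n≡m kc≤n) ⟩
      l + n           ≡⟨ l+n≡[1+k]c ⟩
      c + k * c       ∎)

  parts-deficient : n < k * c → n ≤ k * l
  parts-deficient n<kc = +-cancelʳ-≤ (k * n) n (k * l) (begin
    n + k * n         ≤⟨ *-monoʳ-≤ (suc k) (<⇒≤ n<kc) ⟩
    suc k * (k * c)   ≡⟨ solve 2 (λ k c → (con 1 :+ k) :* (k :* c) := k :* ((con 1 :+ k) :* c)) refl k c ⟩
    k * (suc k * c)   ≡⟨ cong (k *_) l+n≡[1+k]c ⟨
    k * (l + n)       ≡⟨ *-distribˡ-+ k l n ⟩
    k * l + k * n     ∎)
    where
    open ≤-Reasoning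
    open +-*-Solver

module _ {k c′ n qa Qv : ℕ} (1≤k : 1 ≤ k) (n≤[1+k]c : n ≤ suc k * suc c′) where

  private
    c = suc c′
    K = k * suc k
    l = suc k * c ∸ n
    m = n ∸ k * c

  Q≤-balanced : ∀ {qb} → k * c ≤ n → qSmall l k qa → qSmall m (suc k) qb → QNC n c Qv → Qv ≤ qa + qb
  Q≤-balanced kc≤n qs-l qs-m =
    weighted⇒Q≤ (cast n-parts total-parts (joinWeighted (weaken (n≤1+n k) g-l) g-m)) c′K<Kc
    where
    g-l : WeightedGraph (suc k) K (k * l) qa (l * K)
    g-l = qSmall⇒weighted refl qs-l
    g-m : WeightedGraph k K (suc k * m) _ (m * K)
    g-m = qSmall⇒weighted (*-comm (suc k) k) qs-m
    l+m≡c = proj₁ (parts-balanced k c n≤[1+k]c kc≤n)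
    n-parts = proj₂ (parts-balanced k c n≤[1+k]c kc≤n)
    total-parts : l * K + m * K ≡ c * K
    total-parts = trans (sym (*-distribʳ-+ K l m)) (cong (_* K) l+m≡c)
    c′K<Kc : c′ * K < c * K
    c′K<Kc = m<n+m (c′ * K) (*-mono-≤ 1≤k (s≤s z≤n))

  Q≤-deficient : k * c′ < n → n < k * c → qSmall l k qa → QNC n c Qv → Qv ≤ qa
  Q≤-deficient kc′<n n<kc qs-l = weighted⇒Q≤-subgraph (qSmall⇒weighted {α = k} {d = suc k} refl qs-l)
    (parts-deficient k c n≤[1+k]c n<kc) (begin-strict
      c′ * (k * suc k) ≡⟨ solve 2 (λ c′ k → c′ :* (k :* (con 1 :+ k)) := k :* c′ :* (con 1 :+ k))
                                  refl c′ k ⟩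
      k * c′ * suc k   <⟨ *-monoˡ-< (suc k) kc′<n ⟩
      n * suc k        ∎)
    where
    open ≤-Reasoning
    open +-*-Solver

theorem3p1 : (r : RealIn01) → InvNotInteger r → (k : ℕ) → IsFloorInv r k →
    ∃[ N ] (∀ n → N ≤ n → 1 ≤ n → (c : ℕ) → IsCeilMul r n c →
    (Qv qa qb : ℕ) → QNC n c Qv →
    qSmall ((suc k) * c ∸ n) k qa → qSmall (n ∸ k * c) (suc k) qb →
    Qv ≤ qa + qb)
theorem3p1 r _ k floor = 0 , bound
  where
  bound : ∀ n → 0 ≤ n → 1 ≤ n → ∀ c → IsCeilMul r n c → ∀ Qv qa qb → QNC n c Qv →
          qSmall (suc k * c ∸ n) k qa → qSmall (n ∸ k * c) (suc k) qb → Qv ≤ qa + qb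
  bound n _ 1≤n zero     (() , _)
  bound n _ 1≤n (suc c′) ceil Qv qa qb Q qs-l qs-m
    with ceil-bounds r floor 1≤n ceil | k * suc c′ ≤? n
  ... | upper , _     | yes kc≤n = Q≤-balanced (proj₁ floor) upper kc≤n qs-l qs-m Q
  ... | upper , kc′<n | no  kc≰n =
    ≤-trans (Q≤-deficient (proj₁ floor) upper kc′<n (≰⇒> kc≰n) qs-l Q) (m≤m+n qa qb)
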